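{- The path collection $\mathcal{P}_{light}=\{\Pi_{\langle x,y\rangle}: \langle x,y\rangle\text{ is an ordered light pair}\}$ satisfies: each path has length $O(D)$, and each edge of $G$ appears in at most $\widetilde{O}(D)$ paths of $\mathcal{P}_{light}$.
   Context: $G=(V,E)$ is a connected $n$-vertex graph of diameter $D$ with no cut vertex; $T$ a BFS tree rooted at $s$; $\pi(u,v)$ the $T$-path and $\circ$ concatenation. $T_x$ the subtree at $x$, $V_x=V(T_x)\setminus\{x\}$, $\mathcal{C}_x$ the components of $G[V_x]$, $C_{x,v}$ the component containing $v\in V_x$. Heavy child $y_h$ of $y$: child with largest subtree (ties broken consistently); other children light; a $T$-edge $(y,y')$ is light if $y'$ is a light child. For every $x$ and $C\in\mathcal{C}_x$ a fixed edge $(u_C,v_C)\in E$ with $v_C\in C$, $u_C\notin V(T_x)$ is chosen, and $\pi_x(s,C)=\pi(s,u_C)\circ(u_C,v_C)$. An ordered pair $\langle x,y\rangle$ of vertices neither of which is a $T$-ancestor of the other is an ordered light pair if there is $C\in\mathcal{C}_x$ such that either $y=u_C$, or $\pi_x(s,C)$ contains a light $T$-edge $(y,y')$ with $x\in\pi_y(s,C_{y,y'})$. For each ordered light pair an arbitrary such component $C^{\langle x,y\rangle}$ is fixed, and $\Pi_{\langle x,y\rangle}=\pi(x,v_{C^{\langle x,y\rangle}})\circ(v_{C^{\langle x,y\rangle}},u_{C^{\langle x,y\rangle}})\circ\pi(u_{C^{\langle x,y\rangle}},y)$. $\widetilde{O}$ hides polylog$(n)$ factors. -}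

module Defs where

open import Data.Nat using (ℕ; zero; suc; _+_; _*_; _∸_; _^_; _≤_)
open import Data.Fin using (Fin; _≟_)
open import Data.Bool using (Bool; true; false)
open import Data.List using (List; []; _∷_; _++_; length; reverse; filter; zip; drop; allFin)
open import Data.Product using (Σ; _×_; _,_; proj₁; proj₂)
open import Data.Sum using (_⊎_)
open import Relation.Nullary using (¬_; yes; no)
open import Relation.Binary.PropositionalEquality using (_≡_; _≢_)
import Data.List.Membership.Propositional as MemP
import Data.List.Membership.DecPropositional as MemD

record Graph (n : ℕ) : Set where
  field
    adj    : Fin n → Fin n → Bool
    sym    : ∀ u v → adj u v ≡ adj v u
    irrefl : ∀ u → adj u u ≡ false

module GraphNotions {n : ℕ} (G : Graph n) where
  open Graph G

  data Walk : Fin n → Fin n → ℕ → Set where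
    wnil  : ∀ {u} → Walk u u 0
    wcons : ∀ {u w v k} → adj u w ≡ true → Walk w v k → Walk u v (suc k)

  -- walks all of whose vertices satisfy P (connectivity inside G[P])
  data WalkIn (P : Fin n → Set) : Fin n → Fin n → Set where
    inil  : ∀ {u} → P u → WalkIn P u u
    icons : ∀ {u w v} → P u → adj u w ≡ true → WalkIn P w v → WalkIn P u v

  IsDist : Fin n → Fin n → ℕ → Set
  IsDist u v k = Walk u v k × (∀ k' → Walk u v k' → k ≤ k')

  IsDiameter : ℕ → Set
  IsDiameter D = (∀ u v → Σ ℕ λ k → k ≤ D × Walk u v k)
               × Σ (Fin n) λ u → Σ (Fin n) λ v → ∀ k → Walk u v k → D ≤ k

  NoCutVertex : Set
  NoCutVertex = ∀ z u v → u ≢ z → v ≢ z → WalkIn (λ w → w ≢ z) u v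

  IsBFSTree : Fin n → (Fin n → Fin n) → Set
  IsBFSTree s parent =
    parent s ≡ s ×
    Σ (Fin n → ℕ) λ d →
      (∀ v → IsDist s v (d v)) ×
      (∀ v → v ≢ s → adj v (parent v) ≡ true × suc (d (parent v)) ≡ d v)

module Tree {n : ℕ} (parent : Fin n → Fin n) where
  open MemD (_≟_ {n}) using (_∈?_)
  open MemP using (_∈_)

  -- v, parent v, parent² v, …  (n+1 entries; contains all ancestors)
  up : ℕ → Fin n → List (Fin n)
  up zero v = v ∷ []
  up (suc k) v = v ∷ up k (parent v)

  ancestors : Fin n → List (Fin n)
  ancestors v = up n v

  -- a is a T-ancestor of v (reflexive: v is its own ancestor), i.e. v ∈ V(T_a)
  IsAnc : Fin n → Fin n → Set
  IsAnc a v = a ∈ ancestors v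

  InV : Fin n → Fin n → Set
  InV x v = IsAnc x v × v ≢ x

  size : Fin n → ℕ
  size x = length (filter (λ v → x ∈? ancestors v) (allFin n))

  Child : Fin n → Fin n → Set
  Child y c = parent c ≡ y × c ≢ y

  climb : ℕ → Fin n → Fin n → List (Fin n)
  climb zero a u = u ∷ []
  climb (suc k) a u with u ≟ a
  ... | yes _ = u ∷ []
  ... | no _  = u ∷ climb k a (parent u)

  firstOr : Fin n → List (Fin n) → Fin n
  firstOr d [] = d
  firstOr d (x ∷ _) = x

  lca : Fin n → Fin n → Fin n
  lca u v = firstOr u (filter (λ a → a ∈? ancestors v) (ancestors u))

  π : Fin n → Fin n → List (Fin n)
  π u v = climb n (lca u v) u ++ drop 1 (reverse (climb n (lca u v) v))

pairs : ∀ {n} → List (Fin n) → List (Fin n × Fin n)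
pairs p = zip p (drop 1 p)

UsesEdge : ∀ {n} → Fin n → Fin n → List (Fin n) → Set
UsesEdge a b p = ((a , b) ∈ pairs p) ⊎ ((b , a) ∈ pairs p)
  where open MemP

pathLength : ∀ {n} → List (Fin n) → ℕ
pathLength p = length p ∸ 1

-- Everything attached to the data (G, s, T, heavy children, chosen exit edges
-- (u_C,v_C), chosen components C^<x,y>).
--   heavy y         : the heavy child y_h of y
--   exit x v        : the chosen edge (u_C , v_C) for C = C_{x,v}
--   comp x y        : a vertex of C^<x,y> (the component is C_{x, comp x y})
module Light {n : ℕ} (G : Graph n) (s : Fin n) (parent : Fin n → Fin n)
             (heavy : Fin n → Fin n)
             (exit : Fin n → Fin n → Fin n × Fin n)
             (comp : Fin n → Fin n → Fin n) where
  open Graph G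
  open GraphNotions G
  open Tree parent
  open MemP using (_∈_)

  IsHeavyChoice : Set
  IsHeavyChoice = ∀ y c → Child y c → Child y (heavy y) × size c ≤ size (heavy y)

  ConnIn : Fin n → Fin n → Fin n → Set
  ConnIn x u v = WalkIn (InV x) u v

  IsExitChoice : Set
  IsExitChoice =
    (∀ x v → x ≢ s → InV x v →
       adj (proj₁ (exit x v)) (proj₂ (exit x v)) ≡ true
       × ConnIn x v (proj₂ (exit x v))
       × ¬ IsAnc x (proj₁ (exit x v)))
    × (∀ x v v' → x ≢ s → ConnIn x v v' → exit x v ≡ exit x v')

  LightEdge : Fin n → Fin n → Set
  LightEdge y y' = Child y y' × y' ≢ heavy y

  πs : Fin n → Fin n → List (Fin n)
  πs x v = π s (proj₁ (exit x v)) ++ (proj₂ (exit x v) ∷ [])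

  LightWitness : Fin n → Fin n → Fin n → Set
  LightWitness x y v =
    InV x v ×
    ((y ≡ proj₁ (exit x v)) ⊎
     Σ (Fin n) λ y' → LightEdge y y' × UsesEdge y y' (πs x v) × x ∈ πs y y')

  OrderedLightPair : Fin n → Fin n → Set
  OrderedLightPair x y = ¬ IsAnc x y × ¬ IsAnc y x × Σ (Fin n) λ v → LightWitness x y v

  IsCompChoice : Set
  IsCompChoice = ∀ x y → OrderedLightPair x y → LightWitness x y (comp x y)

  -- Π_<x,y> = π(x,v_C) ∘ (v_C,u_C) ∘ π(u_C,y) with C = C^<x,y>
  Π : Fin n → Fin n → List (Fin n)
  Π x y = π x (proj₂ (exit x (comp x y))) ++ π (proj₁ (exit x (comp x y))) y

-- An ordered light pair ⟨x , y⟩ has Π_⟨x,y⟩ made of two T-paths, each of length at most 2D, and one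
-- edge. An edge {a , b} of Π_⟨x,y⟩ is either the edge (v_C , u_C), a tree edge of π(x , v_C) below x,
-- or a tree edge of π(u_C , y) below y. In the first two cases an endpoint w lies in the component C of
-- G[V_x], so x is one of the at most D + 1 ancestors of w, C = C_{x,w}, and y is u_C or the
-- parent of one of the light ancestors of u_C. In the last case y is the parent of a light ancestor y' of
-- w and x lies on π_y(s , C_{y,y'}), which has at most 2D + 2 vertices. Since a light child has at most
-- half the subtree of its parent, every vertex has at most log₂ n light ancestors; so an edge lies on
-- O(D log n) paths of 𝒫_light.
module Submission where

open import Defs
open import Data.Nat using (ℕ; zero; suc; _+_; _*_; _∸_; _^_; _≤_; _<_; z≤n; s≤s; _≤?_)
open import Data.Nat.Properties
open import Data.Nat.Logarithm using (⌊log₂_⌋; ⌊log₂⌋-mono-≤; ⌊log₂[2^n]⌋≡n)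
open import Data.Nat.Tactic.RingSolver using (solve-∀)
open import Data.Fin using (Fin; toℕ) renaming (_≟_ to _≟ᶠ_)
import Data.Fin.Properties as Fin
open import Data.Bool using (true)
open import Data.List using (List; []; _∷_; _++_; length; reverse; drop; zip; map; filter; concatMap; allFin)
open import Data.List.Properties
  using (unfold-reverse; length-++; ++-identityʳ; length-drop; length-reverse; length-map; length-filter; length-tabulate)
open import Data.List.Membership.Propositional using (_∈_; lose)
open import Data.List.Membership.Propositional.Properties
  using (∈-∃++; ∈-++⁺ˡ; ∈-++⁺ʳ; ∈-++⁻; ∈-concatMap⁺; ∈-map⁺; ∈-filter⁺; ∈-allFin; ∈-length)
open import Data.List.Relation.Binary.Subset.Propositional using (_⊆_)
open import Data.List.Relation.Unary.Any using (here; there)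
open import Data.List.Relation.Unary.All using (All; _∷_)
import Data.List.Relation.Unary.All as All
open import Data.List.Relation.Unary.Unique.Propositional using (Unique)
open import Data.List.Relation.Unary.AllPairs.Core using ([]; _∷_)
open import Data.Product using (Σ; _×_; _,_; proj₁; proj₂)
open import Data.Sum using (_⊎_; inj₁; inj₂; [_,_])
open import Data.Empty using (⊥; ⊥-elim)
open import Relation.Nullary using (¬_; yes; no)
open import Relation.Unary using (Decidable)
open import Relation.Binary.PropositionalEquality
  using (_≡_; _≢_; refl; sym; trans; cong; subst; ≢-sym; module ≡-Reasoning)
open import Function using (_∘_)

module _ {A : Set} where

  data Consecutive (x y : A) : List A → Set where
    front : ∀ {l} → Consecutive x y (x ∷ y ∷ l)
    next  : ∀ {w l} → Consecutive x y l → Consecutive x y (w ∷ l)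

  data Last (x : A) : List A → Set where
    end  : Last x (x ∷ [])
    skip : ∀ {w l} → Last x l → Last x (w ∷ l)

  Head : A → List A → Set
  Head y []      = ⊥
  Head y (z ∷ _) = y ≡ z

  zip-drop⇒Consecutive : ∀ {x y} (l : List A) → (x , y) ∈ zip l (drop 1 l) → Consecutive x y l
  zip-drop⇒Consecutive (a ∷ b ∷ l) (here refl) = front
  zip-drop⇒Consecutive (a ∷ b ∷ l) (there p)   = next (zip-drop⇒Consecutive (b ∷ l) p)

  ¬Consecutive-[_] : ∀ {x y} (w : A) → ¬ Consecutive x y (w ∷ [])
  ¬Consecutive-[ w ] (next ())

  Head-++ : ∀ {x} {l : List A} r → Head x l → Head x (l ++ r)
  Head-++ {l = _ ∷ _} r h = h

  Last-unique : ∀ {x z} {l : List A} → Last x l → Last z l → x ≡ z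
  Last-unique end       end       = refl
  Last-unique end       (skip ())
  Last-unique (skip ()) end
  Last-unique (skip lx) (skip lz) = Last-unique lx lz

  Last-++⁻ : ∀ {x b r} (l : List A) → Last x (l ++ b ∷ r) → Last x (b ∷ r)
  Last-++⁻ []           lx        = lx
  Last-++⁻ (w ∷ [])     (skip lx) = lx
  Last-++⁻ (w ∷ w' ∷ l) (skip lx) = Last-++⁻ (w' ∷ l) lx

  Consecutive-++⁻ : ∀ {x y} (l₁ l₂ : List A) → Consecutive x y (l₁ ++ l₂) →
                    Consecutive x y l₁ ⊎ Consecutive x y l₂ ⊎ (Last x l₁ × Head y l₂)
  Consecutive-++⁻ []             l₂       c        = inj₂ (inj₁ c)
  Consecutive-++⁻ (w ∷ [])       (z ∷ l₂) front    = inj₂ (inj₂ (end , refl))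
  Consecutive-++⁻ (w ∷ [])       l₂       (next c) = inj₂ (inj₁ c)
  Consecutive-++⁻ (w ∷ w' ∷ l₁)  l₂       front    = inj₁ front
  Consecutive-++⁻ (w ∷ w' ∷ l₁)  l₂       (next c) with Consecutive-++⁻ (w' ∷ l₁) l₂ c
  ... | inj₁ c₁              = inj₁ (next c₁)
  ... | inj₂ (inj₁ c₂)       = inj₂ (inj₁ c₂)
  ... | inj₂ (inj₂ (lx , hy)) = inj₂ (inj₂ (skip lx , hy))

  Consecutive-glue⁻ : ∀ {x y z} (l₁ l₂ : List A) → Last z l₁ → Head z l₂ →
                      Consecutive x y (l₁ ++ drop 1 l₂) → Consecutive x y l₁ ⊎ Consecutive x y l₂
  Consecutive-glue⁻ l₁ (z ∷ l₂) lz refl c with Consecutive-++⁻ l₁ l₂ c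
  ... | inj₁ c₁               = inj₁ c₁
  ... | inj₂ (inj₁ c₂)        = inj₂ (next c₂)
  ... | inj₂ (inj₂ (lx , hy)) with Last-unique lx lz | l₂ | hy
  ...   | refl | _ ∷ _ | refl = inj₂ front

  Last-glue⁻ : ∀ {x z} (l₁ l₂ : List A) → Last z l₁ → Head z l₂ →
               Last x (l₁ ++ drop 1 l₂) → Last x l₂
  Last-glue⁻ l₁ (z ∷ []) lz refl lx
    rewrite ++-identityʳ l₁ | Last-unique lx lz = end
  Last-glue⁻ l₁ (z ∷ b ∷ r) lz refl lx = skip (Last-++⁻ l₁ lx)

  Last-∷ʳ⁻ : ∀ {x v} (l : List A) → Last x (l ++ v ∷ []) → x ≡ v
  Last-∷ʳ⁻ l lx with Last-++⁻ l lx
  ... | end = refl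

  Last⇒Head-reverse : ∀ {x} {l : List A} → Last x l → Head x (reverse l)
  Last⇒Head-reverse end = refl
  Last⇒Head-reverse (skip {w} {l} lx)
    rewrite unfold-reverse w l = Head-++ (w ∷ []) (Last⇒Head-reverse lx)

  Last-reverse⁻ : ∀ {x} (l : List A) → Last x (reverse l) → Head x l
  Last-reverse⁻ (w ∷ l) lx rewrite unfold-reverse w l = Last-∷ʳ⁻ (reverse l) lx

  Consecutive-reverse⁻ : ∀ {x y} (l : List A) → Consecutive x y (reverse l) → Consecutive y x l
  Consecutive-reverse⁻ (w ∷ l) c rewrite unfold-reverse w l
    with Consecutive-++⁻ (reverse l) (w ∷ []) c
  ... | inj₁ c₁               = next (Consecutive-reverse⁻ l c₁)
  ... | inj₂ (inj₁ c₂)        = ⊥-elim (¬Consecutive-[ w ] c₂)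
  ... | inj₂ (inj₂ (lx , refl)) with l | Last-reverse⁻ l lx
  ...   | _ ∷ _ | refl = front

  ∈-remove : ∀ {e} (C : List A) → e ∈ C → Σ (List A) λ C' →
             suc (length C') ≡ length C × (∀ {z} → z ∈ C → z ≢ e → z ∈ C')
  ∈-remove {e} C e∈C with ∈-∃++ e∈C
  ... | C₁ , C₂ , refl = C₁ ++ C₂ , length-removed , keep
    where
    length-removed : suc (length (C₁ ++ C₂)) ≡ length (C₁ ++ e ∷ C₂)
    length-removed rewrite length-++ C₁ {C₂} | length-++ C₁ {e ∷ C₂} =
      sym (+-suc (length C₁) (length C₂))
    keep : ∀ {z} → z ∈ C₁ ++ e ∷ C₂ → z ≢ e → z ∈ C₁ ++ C₂
    keep z∈ z≢e with ∈-++⁻ C₁ z∈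
    ... | inj₁ z∈C₁         = ∈-++⁺ˡ z∈C₁
    ... | inj₂ (here z≡e)   = ⊥-elim (z≢e z≡e)
    ... | inj₂ (there z∈C₂) = ∈-++⁺ʳ C₁ z∈C₂

  Unique-⊆⇒length≤ : ∀ {L C : List A} → Unique L → L ⊆ C → length L ≤ length C
  Unique-⊆⇒length≤ {[]}    _            _   = z≤n
  Unique-⊆⇒length≤ {e ∷ L} {C} (e∉L ∷ uL) L⊆C with ∈-remove C (L⊆C (here refl))
  ... | C' , length-C , keep = subst (suc (length L) ≤_) length-C
          (s≤s (Unique-⊆⇒length≤ uL (λ z∈L → keep (L⊆C (there z∈L)) (≢-head e∉L z∈L))))
    where
    ≢-head : ∀ {z L'} → All (e ≢_) L' → z ∈ L' → z ≢ e
    ≢-head (e≢z ∷ _)  (here refl) z≡e = e≢z (sym z≡e)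
    ≢-head (_ ∷ e≢L') (there z∈L')    = ≢-head e≢L' z∈L'

  module _ {P Q R : A → Set} (P? : Decidable P) (Q? : Decidable Q) (R? : Decidable R) where

    length-filter-disjoint : ∀ (xs : List A) → (∀ {v} → P v → R v) → (∀ {v} → Q v → R v) →
                             (∀ {v} → P v → Q v → ⊥) →
                             length (filter P? xs) + length (filter Q? xs) ≤ length (filter R? xs)
    length-filter-disjoint [] _ _ _ = z≤n
    length-filter-disjoint (x ∷ xs) P⇒R Q⇒R disj
      with ih ← length-filter-disjoint xs P⇒R Q⇒R disj | P? x | Q? x | R? x
    ... | yes p | yes q | _     = ⊥-elim (disj p q)
    ... | yes p | no _  | no ¬r = ⊥-elim (¬r (P⇒R p))
    ... | no _  | yes q | no ¬r = ⊥-elim (¬r (Q⇒R q))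
    ... | yes _ | no _  | yes _ = s≤s ih
    ... | no _  | yes _ | yes _ = subst (_≤ suc (length (filter R? xs)))
                                  (sym (+-suc (length (filter P? xs)) (length (filter Q? xs)))) (s≤s ih)
    ... | no _  | no _  | yes _ = m≤n⇒m≤1+n ih
    ... | no _  | no _  | no _  = ih

  length-filter-mono : ∀ {P R : A → Set} (P? : Decidable P) (R? : Decidable R) (xs : List A) →
                       (∀ {v} → P v → R v) → length (filter P? xs) ≤ length (filter R? xs)
  length-filter-mono P? R? [] _ = z≤n
  length-filter-mono P? R? (x ∷ xs) P⇒R with ih ← length-filter-mono P? R? xs P⇒R | P? x | R? x
  ... | yes p | no ¬r = ⊥-elim (¬r (P⇒R p))
  ... | yes _ | yes _ = s≤s ih
  ... | no _  | yes _ = m≤n⇒m≤1+n ih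
  ... | no _  | no _  = ih

module _ {A B : Set} (f : A → List B) where

  ∈-concatMap-intro : ∀ {xs x y} → x ∈ xs → y ∈ f x → y ∈ concatMap f xs
  ∈-concatMap-intro x∈xs y∈fx = ∈-concatMap⁺ f (lose x∈xs y∈fx)

  length-concatMap≤ : ∀ (xs : List A) {K} → (∀ {x} → x ∈ xs → length (f x) ≤ K) →
                      length (concatMap f xs) ≤ length xs * K
  length-concatMap≤ []       _ = z≤n
  length-concatMap≤ (x ∷ xs) bound rewrite length-++ (f x) {concatMap f xs} =
    +-mono-≤ (bound (here refl)) (length-concatMap≤ xs (bound ∘ there))

module BFSTree {n : ℕ} (G : Graph n) (s : Fin n) (parent : Fin n → Fin n)
               (bfs : GraphNotions.IsBFSTree G s parent) where

  open Graph G using (adj)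
  open GraphNotions G
  open Tree parent
  open import Data.List.Membership.DecPropositional (_≟ᶠ_ {n}) using (_∈?_)

  depth : Fin n → ℕ
  depth = proj₁ (proj₂ bfs)

  parent-root : parent s ≡ s
  parent-root = proj₁ bfs

  depth-minimal : ∀ {v k} → Walk s v k → depth v ≤ k
  depth-minimal = proj₂ (proj₁ (proj₂ (proj₂ bfs)) _) _

  adj-parent : ∀ {v} → v ≢ s → adj v (parent v) ≡ true
  adj-parent v≢s = proj₁ (proj₂ (proj₂ (proj₂ bfs)) _ v≢s)

  depth-parent : ∀ {v} → v ≢ s → suc (depth (parent v)) ≡ depth v
  depth-parent v≢s = proj₂ (proj₂ (proj₂ (proj₂ bfs)) _ v≢s)

  depth-root : depth s ≡ 0
  depth-root = n≤0⇒n≡0 (depth-minimal wnil)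

  depth≡0⇒root : ∀ {v} → depth v ≡ 0 → v ≡ s
  depth≡0⇒root {v} d≡0 = sym (walk₀ (subst (Walk s v) d≡0 (proj₁ (proj₁ (proj₂ (proj₂ bfs)) v))))
    where
    walk₀ : ∀ {a b} → Walk a b 0 → a ≡ b
    walk₀ wnil = refl

  depth>0⇒≢root : ∀ {v} → 0 < depth v → v ≢ s
  depth>0⇒≢root 0<d refl = <⇒≢ 0<d (sym depth-root)

  ≢root⇒depth>0 : ∀ {v} → v ≢ s → 0 < depth v
  ≢root⇒depth>0 v≢s = subst (0 <_) (depth-parent v≢s) (s≤s z≤n)

  depth-parent-∸1 : ∀ v → depth (parent v) ≡ depth v ∸ 1
  depth-parent-∸1 v with v ≟ᶠ s
  ... | yes refl rewrite parent-root | depth-root = refl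
  ... | no v≢s = cong (_∸ 1) (depth-parent v≢s)

  depth-parent-≤ : ∀ v → depth (parent v) ≤ depth v
  depth-parent-≤ v rewrite depth-parent-∸1 v = m∸n≤m (depth v) 1

  depth-parent-< : ∀ {v} → v ≢ s → depth (parent v) < depth v
  depth-parent-< {v} v≢s = subst (depth (parent v) <_) (depth-parent v≢s) ≤-refl

  parent≢ : ∀ {v} → v ≢ s → parent v ≢ v
  parent≢ v≢s eq = <⇒≢ (depth-parent-< v≢s) (cong depth eq)

  grandparent≢ : ∀ {v} → v ≢ s → parent (parent v) ≢ v
  grandparent≢ {v} v≢s eq =
    <⇒≱ (depth-parent-< v≢s) (subst (λ w → depth w ≤ depth (parent v)) eq (depth-parent-≤ (parent v)))

  parent^ : ℕ → Fin n → Fin n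
  parent^ zero    v = v
  parent^ (suc k) v = parent^ k (parent v)

  parent^-+ : ∀ j i v → parent^ (j + i) v ≡ parent^ i (parent^ j v)
  parent^-+ zero    i v = refl
  parent^-+ (suc j) i v = parent^-+ j i (parent v)

  parent^-root : ∀ k → parent^ k s ≡ s
  parent^-root zero    = refl
  parent^-root (suc k) rewrite parent-root = parent^-root k

  depth-parent^ : ∀ k v → depth (parent^ k v) ≡ depth v ∸ k
  depth-parent^ zero    v = refl
  depth-parent^ (suc k) v rewrite depth-parent^ k (parent v) | depth-parent-∸1 v =
    ∸-+-assoc (depth v) 1 k

  parent^-depth : ∀ {k v} → depth v ≤ k → parent^ k v ≡ s
  parent^-depth {k} {v} d≤k = begin
    parent^ k v                              ≡⟨ cong (λ m → parent^ m v) (sym (m+[n∸m]≡n d≤k)) ⟩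
    parent^ (depth v + (k ∸ depth v)) v      ≡⟨ parent^-+ (depth v) (k ∸ depth v) v ⟩
    parent^ (k ∸ depth v) (parent^ (depth v) v)
      ≡⟨ cong (parent^ (k ∸ depth v)) (depth≡0⇒root (trans (depth-parent^ (depth v) v) (n∸n≡0 (depth v)))) ⟩
    parent^ (k ∸ depth v) s                  ≡⟨ parent^-root (k ∸ depth v) ⟩
    s                                        ∎
    where open ≡-Reasoning

  -- Pigeonhole: the vertices parent^ i v, i ≤ depth v, have pairwise distinct depths.
  depth<n : ∀ v → depth v < n
  depth<n v with suc (depth v) ≤? n
  ... | yes d<n = d<n
  ... | no d≮n with Fin.pigeonhole (≰⇒> d≮n) (λ i → parent^ (toℕ i) v)
  ...   | i , j , i<j , eq = ⊥-elim (<⇒≢ lt (cong depth (sym eq)))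
    where
    lt : depth (parent^ (toℕ j) v) < depth (parent^ (toℕ i) v)
    lt rewrite depth-parent^ (toℕ j) v | depth-parent^ (toℕ i) v =
      ∸-monoʳ-< i<j (≤-pred (Fin.toℕ<n j))

  gap : Fin n → Fin n → ℕ
  gap a v = depth v ∸ depth a

  infix 4 _≼_
  _≼_ : Fin n → Fin n → Set
  a ≼ v = depth a ≤ depth v × parent^ (gap a v) v ≡ a

  parent^-≼ : ∀ {i v} → i ≤ depth v → parent^ i v ≼ v
  parent^-≼ {i} {v} i≤d rewrite depth-parent^ i v =
    m∸n≤m (depth v) i , cong (λ k → parent^ k v) (m∸[m∸n]≡n i≤d)

  ≼-refl : ∀ {v} → v ≼ v
  ≼-refl = parent^-≼ z≤n

  root-≼ : ∀ {v} → s ≼ v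
  root-≼ {v} = subst (_≼ v) (parent^-depth ≤-refl) (parent^-≼ ≤-refl)

  parent-≼ : ∀ {v} → v ≢ s → parent v ≼ v
  parent-≼ v≢s = parent^-≼ (≢root⇒depth>0 v≢s)

  private
    gap-+ : ∀ {a b v} → depth a ≤ depth b → depth b ≤ depth v → gap b v + gap a b ≡ gap a v
    gap-+ {a} a≤b b≤v = trans (sym (+-∸-assoc _ a≤b)) (cong (_∸ depth a) (m∸n+n≡m b≤v))

  ≼-trans : ∀ {a b v} → a ≼ b → b ≼ v → a ≼ v
  ≼-trans {a} {b} {v} (a≤b , b↑a) (b≤v , v↑b) = ≤-trans a≤b b≤v , (begin
    parent^ (gap a v) v                      ≡⟨ cong (λ k → parent^ k v) (sym (gap-+ a≤b b≤v)) ⟩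
    parent^ (gap b v + gap a b) v            ≡⟨ parent^-+ (gap b v) (gap a b) v ⟩
    parent^ (gap a b) (parent^ (gap b v) v)  ≡⟨ cong (parent^ (gap a b)) v↑b ⟩
    parent^ (gap a b) b                      ≡⟨ b↑a ⟩
    a                                        ∎)
    where open ≡-Reasoning

  ≼-by-depth : ∀ {a b v} → a ≼ v → b ≼ v → depth a ≤ depth b → a ≼ b
  ≼-by-depth {a} {b} {v} (_ , v↑a) (b≤v , v↑b) a≤b = a≤b , (begin
    parent^ (gap a b) b                      ≡⟨ cong (parent^ (gap a b)) (sym v↑b) ⟩
    parent^ (gap a b) (parent^ (gap b v) v)  ≡⟨ sym (parent^-+ (gap b v) (gap a b) v) ⟩
    parent^ (gap b v + gap a b) v            ≡⟨ cong (λ k → parent^ k v) (gap-+ a≤b b≤v) ⟩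
    parent^ (gap a v) v                      ≡⟨ v↑a ⟩
    a                                        ∎)
    where open ≡-Reasoning

  ≼-same-depth : ∀ {a b v} → a ≼ v → b ≼ v → depth a ≡ depth b → a ≡ b
  ≼-same-depth {v = v} (_ , v↑a) (_ , v↑b) da≡db =
    trans (sym v↑a) (trans (cong (λ d → parent^ (depth v ∸ d) v) da≡db) v↑b)

  ≼⇒depth≤ : ∀ {a v} → a ≼ v → depth a ≤ depth v
  ≼⇒depth≤ = proj₁

  ≼-≢⇒depth< : ∀ {a v} → a ≼ v → a ≢ v → depth a < depth v
  ≼-≢⇒depth< a≼v a≢v with m≤n⇒m<n∨m≡n (≼⇒depth≤ a≼v)
  ... | inj₁ lt = lt
  ... | inj₂ eq = ⊥-elim (a≢v (≼-same-depth a≼v ≼-refl eq))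

  ≼-parent : ∀ {a v} → a ≼ v → parent a ≼ v
  ≼-parent {a} a≼v with a ≟ᶠ s
  ... | yes refl rewrite parent-root = a≼v
  ... | no a≢s   = ≼-trans (parent-≼ a≢s) a≼v

  ∈-up⁻ : ∀ {a} m v → a ∈ up m v → Σ ℕ λ i → i ≤ m × parent^ i v ≡ a
  ∈-up⁻ zero    v (here refl) = 0 , z≤n , refl
  ∈-up⁻ (suc m) v (here refl) = 0 , z≤n , refl
  ∈-up⁻ (suc m) v (there a∈)  with ∈-up⁻ m (parent v) a∈
  ... | i , i≤m , eq = suc i , s≤s i≤m , eq

  parent^-∈-up : ∀ {i} m v → i ≤ m → parent^ i v ∈ up m v
  parent^-∈-up {zero}  zero    v _         = here refl
  parent^-∈-up {zero}  (suc m) v _         = here refl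
  parent^-∈-up {suc i} (suc m) v (s≤s i≤m) = there (parent^-∈-up m (parent v) i≤m)

  ≼⇒∈-up : ∀ {a v m} → a ≼ v → depth v ≤ m → a ∈ up m v
  ≼⇒∈-up {a} {v} {m} (_ , v↑a) d≤m =
    subst (_∈ up m v) v↑a (parent^-∈-up m v (≤-trans (m∸n≤m (depth v) (depth a)) d≤m))

  ≼⇒IsAnc : ∀ {a v} → a ≼ v → IsAnc a v
  ≼⇒IsAnc a≼v = ≼⇒∈-up a≼v (<⇒≤ (depth<n _))

  IsAnc⇒≼ : ∀ {a v} → IsAnc a v → a ≼ v
  IsAnc⇒≼ {a} {v} a∈ with ∈-up⁻ n v a∈
  ... | i , _ , v↑a with i ≤? depth v
  ...   | yes i≤d = subst (_≼ v) v↑a (parent^-≼ i≤d)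
  ...   | no  i≰d = subst (_≼ v) (trans (sym (parent^-depth (<⇒≤ (≰⇒> i≰d)))) v↑a) root-≼

  private
    firstOr-filter-up : ∀ {P : Fin n → Set} (P? : Decidable P) dflt m u {i} → i ≤ m → P (parent^ i u) →
      Σ ℕ λ j → j ≤ i × firstOr dflt (filter P? (up m u)) ≡ parent^ j u × P (parent^ j u)
    firstOr-filter-up P? dflt zero u z≤n Pu with P? u
    ... | yes Pu' = 0 , z≤n , refl , Pu'
    ... | no ¬Pu  = ⊥-elim (¬Pu Pu)
    firstOr-filter-up P? dflt (suc m) u {i} i≤m Pi with P? u
    ... | yes Pu = 0 , z≤n , refl , Pu
    firstOr-filter-up P? dflt (suc m) u {zero}  _         Pu | no ¬Pu = ⊥-elim (¬Pu Pu)
    firstOr-filter-up P? dflt (suc m) u {suc i} (s≤s i≤m) Pi | no _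
      with firstOr-filter-up P? dflt m (parent u) i≤m Pi
    ... | j , j≤i , eq , Pj = suc j , s≤s j≤i , eq , Pj

    lca-search : ∀ u v {i} → i ≤ depth u → parent^ i u ≼ v →
      Σ ℕ λ j → j ≤ i × lca u v ≡ parent^ j u × lca u v ≼ v
    lca-search u v i≤d ≼v
      with firstOr-filter-up (λ a → a ∈? ancestors v) u n u (≤-trans i≤d (<⇒≤ (depth<n u))) (≼⇒IsAnc ≼v)
    ... | j , j≤i , eq , anc = j , j≤i , eq , subst (_≼ v) (sym eq) (IsAnc⇒≼ anc)

  lca-≼ : ∀ u v → lca u v ≼ u × lca u v ≼ v
  lca-≼ u v with lca-search u v {depth u} ≤-refl (subst (_≼ v) (sym (parent^-depth ≤-refl)) root-≼)
  ... | j , j≤d , eq , l≼v = subst (_≼ u) (sym eq) (parent^-≼ j≤d) , l≼v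

  lca-greatest : ∀ {u v w} → w ≼ u → w ≼ v → depth w ≤ depth (lca u v)
  lca-greatest {u} {v} {w} (w≤u , u↑w) w≼v
    with lca-search u v (m∸n≤m (depth u) (depth w)) (subst (_≼ v) (sym u↑w) w≼v)
  ... | j , j≤gap , eq , _ rewrite eq | depth-parent^ j u =
    subst (_≤ depth u ∸ j) (m∸[m∸n]≡n w≤u) (∸-monoʳ-≤ (depth u) j≤gap)

  private
    climb-up : ∀ k a u j → j ≤ k → parent^ j u ≡ a → (∀ {i} → i < j → parent^ i u ≢ a) →
               climb k a u ≡ up j u
    climb-up zero    a u zero    _         _    _     = refl
    climb-up (suc k) a u j       j≤k       u↑a  first with u ≟ᶠ a
    climb-up (suc k) a u zero    _         _    _     | yes _   = refl
    climb-up (suc k) a u (suc j) _         _    first | yes u≡a = ⊥-elim (first (s≤s z≤n) u≡a)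
    climb-up (suc k) a u zero    _         u≡a  _     | no u≢a  = ⊥-elim (u≢a u≡a)
    climb-up (suc k) a u (suc j) (s≤s j≤k) u↑a  first | no _    =
      cong (u ∷_) (climb-up k a (parent u) j j≤k u↑a (first ∘ s≤s))

    below-≼ : ∀ {a w i} → a ≼ w → i < gap a w → parent^ i w ≼ w × depth a < depth (parent^ i w)
    below-≼ {a} {w} {i} (a≤w , _) i<gap = parent^-≼ (≤-trans (<⇒≤ i<gap) (m∸n≤m (depth w) (depth a))) , a<
      where
      a< : depth a < depth (parent^ i w)
      a< rewrite depth-parent^ i w =
        subst (_< depth w ∸ i) (m∸[m∸n]≡n a≤w) (∸-monoʳ-< i<gap (m∸n≤m (depth w) (depth a)))

  climb-≼ : ∀ {a u} → a ≼ u → climb n a u ≡ up (gap a u) u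
  climb-≼ {a} {u} a≼u@(_ , u↑a) =
    climb-up n a u (gap a u) (≤-trans (m∸n≤m (depth u) (depth a)) (<⇒≤ (depth<n u))) u↑a first
    where
    first : ∀ {i} → i < gap a u → parent^ i u ≢ a
    first i<gap eq = <⇒≢ (proj₂ (below-≼ a≼u i<gap)) (cong depth (sym eq))

  π-up : ∀ u v → π u v ≡ up (gap (lca u v) u) u ++ drop 1 (reverse (up (gap (lca u v) v) v))
  π-up u v rewrite climb-≼ (proj₁ (lca-≼ u v)) | climb-≼ (proj₂ (lca-≼ u v)) = refl

  length-up : ∀ j u → length (up j u) ≡ suc j
  length-up zero    u = refl
  length-up (suc j) u = cong suc (length-up j (parent u))

  length-up-glue : ∀ i j u v → length (up i u ++ drop 1 (reverse (up j v))) ≡ suc (i + j)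
  length-up-glue i j u v
    rewrite length-++ (up i u) {drop 1 (reverse (up j v))} | length-up i u
          | length-drop 1 (reverse (up j v)) | length-reverse (up j v) | length-up j v = refl

  length-π : ∀ u v → length (π u v) ≤ suc (depth u + depth v)
  length-π u v = begin
    length (π u v)                ≡⟨ cong length (π-up u v) ⟩
    length (up (gap l u) u ++ drop 1 (reverse (up (gap l v) v)))
                                  ≡⟨ length-up-glue (gap l u) (gap l v) u v ⟩
    suc (gap l u + gap l v)       ≤⟨ s≤s (+-mono-≤ (m∸n≤m (depth u) (depth l)) (m∸n≤m (depth v) (depth l))) ⟩
    suc (depth u + depth v)       ∎
    where
    open ≤-Reasoning
    l = lca u v

  Consecutive-up : ∀ {a b} j u → Consecutive a b (up j u) →
                   Σ ℕ λ i → i < j × a ≡ parent^ i u × b ≡ parent a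
  Consecutive-up zero          u (next ())
  Consecutive-up (suc zero)    u front    = 0 , s≤s z≤n , refl , refl
  Consecutive-up (suc (suc j)) u front    = 0 , s≤s z≤n , refl , refl
  Consecutive-up (suc j)       u (next c) with Consecutive-up j (parent u) c
  ... | i , i<j , a≡ , b≡ = suc i , s≤s i<j , a≡ , b≡

  Last-up : ∀ j u → Last (parent^ j u) (up j u)
  Last-up zero    u = end
  Last-up (suc j) u = skip (Last-up j (parent u))

  Head-up : ∀ {x} j u → Head x (up j u) → x ≡ u
  Head-up zero    u x≡u = x≡u
  Head-up (suc j) u x≡u = x≡u

  ≼⇒Last-up : ∀ {a w} → a ≼ w → Last a (up (gap a w) w)
  ≼⇒Last-up {a} {w} (_ , w↑a) = subst (λ x → Last x (up (gap a w) w)) w↑a (Last-up (gap a w) w)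

  TreeEdge : Fin n → Fin n → Fin n → Set
  TreeEdge a b z = (a ≡ z × b ≡ parent z) ⊎ (a ≡ parent z × b ≡ z)

  π-climbs : ∀ {a b} u v → Consecutive a b (π u v) →
             Consecutive a b (up (gap (lca u v) u) u) ⊎ Consecutive b a (up (gap (lca u v) v) v)
  π-climbs {a} {b} u v c
    with Consecutive-glue⁻ (up (gap (lca u v) u) u) (reverse (up (gap (lca u v) v) v))
           (≼⇒Last-up (proj₁ (lca-≼ u v))) (Last⇒Head-reverse (≼⇒Last-up (proj₂ (lca-≼ u v))))
           (subst (Consecutive a b) (π-up u v) c)
  ... | inj₁ c-u = inj₁ c-u
  ... | inj₂ c-v = inj₂ (Consecutive-reverse⁻ (up (gap (lca u v) v) v) c-v)

  TreeEdge-child : ∀ {c p z} → parent c ≡ p → z ≢ s → TreeEdge p c z ⊎ TreeEdge c p z → c ≡ z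
  TreeEdge-child c↑p z≢s (inj₁ (inj₁ (refl , refl))) = ⊥-elim (grandparent≢ z≢s c↑p)
  TreeEdge-child c↑p z≢s (inj₁ (inj₂ (_ , c≡z)))     = c≡z
  TreeEdge-child c↑p z≢s (inj₂ (inj₁ (c≡z , _)))     = c≡z
  TreeEdge-child c↑p z≢s (inj₂ (inj₂ (refl , refl))) = ⊥-elim (grandparent≢ z≢s c↑p)

  π-edge : ∀ {a b} u v → Consecutive a b (π u v) →
           Σ (Fin n) λ z → TreeEdge a b z × (z ≼ u ⊎ z ≼ v) × depth (lca u v) < depth z
  π-edge u v c with π-climbs u v c
  ... | inj₁ c-u with Consecutive-up (gap (lca u v) u) u c-u
  ...   | i , i<gap , refl , refl =
    let z≼u , l<z = below-≼ (proj₁ (lca-≼ u v)) i<gap in _ , inj₁ (refl , refl) , inj₁ z≼u , l<z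
  π-edge u v c | inj₂ c-v with Consecutive-up (gap (lca u v) v) v c-v
  ...   | i , i<gap , refl , refl =
    let z≼v , l<z = below-≼ (proj₂ (lca-≼ u v)) i<gap in _ , inj₂ (refl , refl) , inj₂ z≼v , l<z

  π-edge-descending : ∀ {a b e f} → a ≼ b → Consecutive e f (π a b) →
                      Σ (Fin n) λ z → TreeEdge e f z × z ≼ b × depth a < depth z
  π-edge-descending a≼b c with π-edge _ _ c
  ... | z , edge , inj₁ z≼a , l<z = ⊥-elim (<⇒≱ (≤-<-trans (lca-greatest ≼-refl a≼b) l<z) (≼⇒depth≤ z≼a))
  ... | z , edge , inj₂ z≼b , l<z = z , edge , z≼b , ≤-<-trans (lca-greatest ≼-refl a≼b) l<z

  π-edge-ascending : ∀ {a b e f} → a ≼ b → Consecutive e f (π b a) →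
                     Σ (Fin n) λ z → TreeEdge e f z × z ≼ b × depth a < depth z
  π-edge-ascending a≼b c with π-edge _ _ c
  ... | z , edge , inj₁ z≼b , l<z = z , edge , z≼b , ≤-<-trans (lca-greatest a≼b ≼-refl) l<z
  ... | z , edge , inj₂ z≼a , l<z = ⊥-elim (<⇒≱ (≤-<-trans (lca-greatest a≼b ≼-refl) l<z) (≼⇒depth≤ z≼a))

  Last-π : ∀ {x} u v → Last x (π u v) → x ≡ v
  Last-π {x} u v lx =
    Head-up _ v (Last-reverse⁻ (up (gap l v) v)
      (Last-glue⁻ (up (gap l u) u) (reverse (up (gap l v) v))
         (≼⇒Last-up (proj₁ (lca-≼ u v))) (Last⇒Head-reverse (≼⇒Last-up (proj₂ (lca-≼ u v))))
         (subst (Last x) (π-up u v) lx)))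
    where l = lca u v

  private
    walk-up : ∀ {P : Fin n → Set} k w → (∀ {i} → i ≤ k → P (parent^ i w)) →
              (∀ {i} → i < k → parent^ i w ≢ s) → WalkIn P w (parent^ k w)
    walk-up zero    w P-all _      = inil (P-all z≤n)
    walk-up (suc k) w P-all ≢root =
      icons (P-all z≤n) (adj-parent (≢root (s≤s z≤n)))
            (walk-up k (parent w) (P-all ∘ s≤s) (≢root ∘ s≤s))

  -- The tree path from v up to z stays strictly below x, hence inside V_x.
  ≼-connected : ∀ {x z v} → x ≼ v → z ≼ v → depth x < depth z → WalkIn (InV x) v z
  ≼-connected {x} {z} {v} x≼v z≼v@(z≤v , v↑z) x<z = subst (WalkIn (InV x) v) v↑z (walk-up (gap z v) v inV ≢root)
    where
    z≤ : ∀ {i} → i ≤ gap z v → depth z ≤ depth (parent^ i v)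
    z≤ {i} i≤gap rewrite depth-parent^ i v = subst (_≤ depth v ∸ i) (m∸[m∸n]≡n z≤v) (∸-monoʳ-≤ (depth v) i≤gap)
    x< : ∀ {i} → i ≤ gap z v → depth x < depth (parent^ i v)
    x< i≤gap = <-≤-trans x<z (z≤ i≤gap)
    inV : ∀ {i} → i ≤ gap z v → InV x (parent^ i v)
    inV {i} i≤gap =
      ≼⇒IsAnc (≼-by-depth x≼v (parent^-≼ (≤-trans i≤gap (m∸n≤m (depth v) (depth z)))) (<⇒≤ (x< i≤gap))) ,
      λ eq → <⇒≢ (x< i≤gap) (cong depth (sym eq))
    ≢root : ∀ {i} → i < gap z v → parent^ i v ≢ s
    ≢root i<gap = depth>0⇒≢root (≤-<-trans z≤n (x< (<⇒≤ i<gap)))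

module HeavyLight {n : ℕ} (G : Graph n) (s : Fin n) (parent : Fin n → Fin n)
                  (bfs : GraphNotions.IsBFSTree G s parent) (heavy : Fin n → Fin n)
                  (heavy-choice : ∀ y c → Tree.Child parent y c →
                                  Tree.Child parent y (heavy y) × Tree.size parent c ≤ Tree.size parent (heavy y))
                  where

  open Tree parent
  open BFSTree G s parent bfs
  open import Data.List.Membership.DecPropositional (_≟ᶠ_ {n}) using (_∈?_)

  size≤n : ∀ x → size x ≤ n
  size≤n x = ≤-trans (length-filter (λ v → x ∈? ancestors v) (allFin n)) (≤-reflexive (length-tabulate (λ i → i)))

  size>0 : ∀ x → 0 < size x
  size>0 x = ∈-length (∈-filter⁺ (λ v → x ∈? ancestors v) (∈-allFin x) (≼⇒IsAnc ≼-refl))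

  size-parent : ∀ z → size z ≤ size (parent z)
  size-parent z = length-filter-mono (λ v → z ∈? ancestors v) (λ v → parent z ∈? ancestors v) (allFin n)
                    (≼⇒IsAnc ∘ ≼-parent ∘ IsAnc⇒≼)

  IsLight : Fin n → Set
  IsLight z = z ≢ s × z ≢ heavy (parent z)

  light? : Decidable IsLight
  light? z with z ≟ᶠ s | z ≟ᶠ heavy (parent z)
  ... | yes z≡s | _       = no (λ l → proj₁ l z≡s)
  ... | no _    | yes z≡h = no (λ l → proj₂ l z≡h)
  ... | no z≢s  | no z≢h  = yes (z≢s , z≢h)

  -- A light child and the heavy child span disjoint subtrees, the heavy one being the larger.
  size-light : ∀ {z} → IsLight z → 2 * size z ≤ size (parent z)
  size-light {z} (z≢s , z≢h) = begin
    2 * size z            ≡⟨ cong (size z +_) (+-identityʳ (size z)) ⟩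
    size z + size z       ≤⟨ +-monoʳ-≤ (size z) (proj₂ heavy-info) ⟩
    size z + size h       ≤⟨ length-filter-disjoint (λ v → z ∈? ancestors v) (λ v → h ∈? ancestors v)
                               (λ v → parent z ∈? ancestors v) (allFin n)
                               (≼⇒IsAnc ∘ ≼-parent ∘ IsAnc⇒≼)
                               (λ h∈ → ≼⇒IsAnc (subst (_≼ _) h-sibling (≼-parent (IsAnc⇒≼ h∈))))
                               (λ z∈ h∈ → z≢h (≼-same-depth (IsAnc⇒≼ z∈) (IsAnc⇒≼ h∈) same-depth)) ⟩
    size (parent z)       ∎
    where
    open ≤-Reasoning
    h = heavy (parent z)
    heavy-info = heavy-choice (parent z) z (refl , ≢-sym (parent≢ z≢s))
    h-sibling : parent h ≡ parent z
    h-sibling = proj₁ (proj₁ heavy-info)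
    h≢s : h ≢ s
    h≢s h≡s = proj₂ (proj₁ heavy-info) (trans h≡s (trans (sym parent-root) (trans (cong parent (sym h≡s)) h-sibling)))
    same-depth : depth z ≡ depth h
    same-depth = trans (sym (depth-parent z≢s)) (trans (cong (suc ∘ depth) (sym h-sibling)) (depth-parent h≢s))

  lightAncestors : ℕ → Fin n → List (Fin n)
  lightAncestors m z = filter light? (up m z)

  -- Each light ancestor at least doubles the subtree size.
  2^light*size≤n : ∀ m z → 2 ^ length (lightAncestors m z) * size z ≤ n
  2^light*size≤n zero z with light? z
  ... | yes l = ≤-trans (size-light l) (size≤n (parent z))
  ... | no _  = ≤-trans (≤-reflexive (+-identityʳ (size z))) (size≤n z)
  2^light*size≤n (suc m) z with ih ← 2^light*size≤n m (parent z) | light? z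
  ... | yes l = begin
    2 ^ suc k * size z     ≡⟨ reassoc (2 ^ k) (size z) ⟩
    2 ^ k * (2 * size z)   ≤⟨ *-monoʳ-≤ (2 ^ k) (size-light l) ⟩
    2 ^ k * size (parent z) ≤⟨ ih ⟩
    n                      ∎
    where
    open ≤-Reasoning
    k = length (lightAncestors m (parent z))
    reassoc : ∀ a b → 2 * a * b ≡ a * (2 * b)
    reassoc = solve-∀
  ... | no _  = ≤-trans (*-monoʳ-≤ (2 ^ length (lightAncestors m (parent z))) (size-parent z)) ih

  length-lightAncestors≤log : ∀ m z → length (lightAncestors m z) ≤ ⌊log₂ n ⌋
  length-lightAncestors≤log m z = subst (_≤ ⌊log₂ n ⌋) (⌊log₂[2^n]⌋≡n k) (⌊log₂⌋-mono-≤ 2^k≤n)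
    where
    k = length (lightAncestors m z)
    2^k≤n : 2 ^ k ≤ n
    2^k≤n = ≤-trans (≤-trans (≤-reflexive (sym (*-identityʳ (2 ^ k)))) (*-monoʳ-≤ (2 ^ k) (size>0 z)))
                    (2^light*size≤n m z)

-- With the slack made explicit each bound is a ring identity; D ≥ 1 absorbs the additive constants.
candidate-count-bound : ∀ D L → 0 < D →
  let B = suc D * suc L + L * (suc (D + D) + 1) in B + B ≤ 12 * D * suc L ^ 12
candidate-count-bound (suc d) L _ = begin
  B + B                     ≤⟨ m≤m+n (B + B) (6 * d * L + 10 * d + 8) ⟩
  B + B + (6 * d * L + 10 * d + 8) ≡⟨ expand d L ⟩
  12 * suc d * suc L        ≤⟨ *-monoʳ-≤ (12 * suc d) (≤-trans (≤-reflexive (sym (*-identityʳ (suc L))))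
                                                        (*-monoʳ-≤ (suc L) (m^n>0 (suc L) 11))) ⟩
  12 * suc d * suc L ^ 12   ∎
  where
  open ≤-Reasoning
  B = suc (suc d) * suc L + L * (suc (suc d + suc d) + 1)
  expand : ∀ d L → let B = suc (suc d) * suc L + L * (suc (suc d + suc d) + 1) in
           B + B + (6 * d * L + 10 * d + 8) ≡ 12 * suc d * suc L
  expand = solve-∀

path-length-bound : ∀ D → 0 < D → suc (D + D) + suc (D + D) ≤ 12 * D
path-length-bound (suc d) _ = begin
  P + P               ≤⟨ m≤m+n (P + P) (8 * d + 6) ⟩
  P + P + (8 * d + 6) ≡⟨ expand d ⟩
  12 * suc d          ∎
  where
  open ≤-Reasoning
  P = suc (suc d + suc d)
  expand : ∀ d → suc (suc d + suc d) + suc (suc d + suc d) + (8 * d + 6) ≡ 12 * suc d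
  expand = solve-∀

module LightPairs {n : ℕ} (G : Graph n) (D : ℕ) (s : Fin n) (parent : Fin n → Fin n)
  (heavy : Fin n → Fin n) (exit : Fin n → Fin n → Fin n × Fin n) (comp : Fin n → Fin n → Fin n)
  (diam : GraphNotions.IsDiameter G D)
  (bfs : GraphNotions.IsBFSTree G s parent)
  (heavy-choice : Light.IsHeavyChoice G s parent heavy exit comp)
  (exit-choice : Light.IsExitChoice G s parent heavy exit comp)
  (comp-choice : Light.IsCompChoice G s parent heavy exit comp) where

  open GraphNotions G
  open Tree parent
  open Light G s parent heavy exit comp
  open BFSTree G s parent bfs
  open HeavyLight G s parent bfs heavy heavy-choice

  depth≤D : ∀ v → depth v ≤ D
  depth≤D v with proj₁ diam s v
  ... | k , k≤D , walk = ≤-trans (depth-minimal walk) k≤D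

  length-π≤ : ∀ u v → length (π u v) ≤ suc (D + D)
  length-π≤ u v = ≤-trans (length-π u v) (s≤s (+-mono-≤ (depth≤D u) (depth≤D v)))

  light-pair⇒D>0 : ∀ {x y} → OrderedLightPair x y → 0 < D
  light-pair⇒D>0 {x} {y} (x⋠y , _) with proj₁ diam x y
  ... | zero  , _   , wnil = ⊥-elim (x⋠y (≼⇒IsAnc ≼-refl))
  ... | suc _ , k≤D , _    = ≤-trans (s≤s z≤n) k≤D

  -- If ⟨x , y⟩ is witnessed by C, then y = u_C or y is the parent of a light ancestor of u_C.
  targetsOf : Fin n → List (Fin n)
  targetsOf u = u ∷ map parent (lightAncestors D u)

  descentCandidates : Fin n → List (Fin n × Fin n)
  descentCandidates w = concatMap (λ x → map (x ,_) (targetsOf (proj₁ (exit x w)))) (up D w)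

  ascentCandidates : Fin n → List (Fin n × Fin n)
  ascentCandidates w = concatMap (λ y' → map (_, parent y') (πs (parent y') y')) (lightAncestors D w)

  candidates : Fin n → List (Fin n × Fin n)
  candidates w = descentCandidates w ++ ascentCandidates w

  edgeCandidates : Fin n → Fin n → List (Fin n × Fin n)
  edgeCandidates a b = candidates a ++ candidates b

  ∈-descentCandidates : ∀ {x y w} → x ≼ w → y ∈ targetsOf (proj₁ (exit x w)) → (x , y) ∈ descentCandidates w
  ∈-descentCandidates {x} {w = w} x≼w y∈ =
    ∈-concatMap-intro (λ x → map (x ,_) (targetsOf (proj₁ (exit x w)))) (≼⇒∈-up x≼w (depth≤D w)) (∈-map⁺ (x ,_) y∈)

  ∈-ascentCandidates : ∀ {x y' w} → IsLight y' → y' ≼ w → x ∈ πs (parent y') y' →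
                       (x , parent y') ∈ ascentCandidates w
  ∈-ascentCandidates {y' = y'} {w} light y'≼w x∈ =
    ∈-concatMap-intro (λ y' → map (_, parent y') (πs (parent y') y'))
      (∈-filter⁺ light? (≼⇒∈-up y'≼w (depth≤D w)) light) (∈-map⁺ (_, parent y') x∈)

  private
    at-endpoint : ∀ {x y a b z} → TreeEdge a b z → (x , y) ∈ candidates z →
                  (x , y) ∈ candidates a ⊎ (x , y) ∈ candidates b
    at-endpoint (inj₁ (refl , _)) m = inj₁ m
    at-endpoint (inj₂ (_ , refl)) m = inj₂ m

  module _ {x y} (pair : OrderedLightPair x y) where

    private
      C = comp x y
      u = proj₁ (exit x C)
      v = proj₂ (exit x C)

      x⋠y : ¬ x ≼ y
      x⋠y = proj₁ pair ∘ ≼⇒IsAnc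

      x≢s : x ≢ s
      x≢s refl = x⋠y root-≼

      C⇝v : ConnIn x C v
      C⇝v = proj₁ (proj₂ (proj₁ exit-choice x C x≢s (proj₁ (comp-choice x y pair))))

      v∈Vₓ : InV x v
      v∈Vₓ = end-of C⇝v
        where
        end-of : ∀ {P a b} → WalkIn P a b → P b
        end-of (inil Pb)     = Pb
        end-of (icons _ _ w) = end-of w

      x≼v : x ≼ v
      x≼v = IsAnc⇒≼ (proj₁ v∈Vₓ)

      x<v : depth x < depth v
      x<v = ≼-≢⇒depth< x≼v (≢-sym (proj₂ v∈Vₓ))

      x≼parent-v : x ≼ parent v
      x≼parent-v = ≼-by-depth x≼v (parent-≼ v≢s) (≤-pred (subst (depth x <_) (sym (depth-parent v≢s)) x<v))
        where
        v≢s : v ≢ s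
        v≢s = depth>0⇒≢root (≤-<-trans z≤n x<v)

      on-πs : ∀ {y' a b} → parent y' ≡ y → Consecutive a b (π s u ++ v ∷ []) →
              (a ≡ y × b ≡ y') ⊎ (a ≡ y' × b ≡ y) → y' ≼ u
      on-πs y'↑y c ends with Consecutive-++⁻ (π s u) (v ∷ []) c
      ... | inj₂ (inj₁ c-v) = ⊥-elim (¬Consecutive-[ v ] c-v)
      ... | inj₂ (inj₂ (_ , b≡v)) with ends
      ...   | inj₁ (_ , refl) = ⊥-elim (x⋠y (subst (x ≼_) (trans (cong parent (sym b≡v)) y'↑y) x≼parent-v))
      ...   | inj₂ (_ , refl) = ⊥-elim (x⋠y (subst (x ≼_) (sym b≡v) x≼v))
      on-πs y'↑y c ends | inj₁ c-su with π-edge-descending root-≼ c-su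
      ... | z , edge , z≼u , s<z =
        subst (_≼ u) (sym (TreeEdge-child y'↑y (depth>0⇒≢root (≤-<-trans z≤n s<z)) (oriented ends edge))) z≼u
        where
        oriented : ∀ {a b y'} → (a ≡ y × b ≡ y') ⊎ (a ≡ y' × b ≡ y) → TreeEdge a b z →
                   TreeEdge y y' z ⊎ TreeEdge y' y z
        oriented (inj₁ (refl , refl)) e = inj₁ e
        oriented (inj₂ (refl , refl)) e = inj₂ e

    -- The light edge (y , y') of the definition cannot be the edge (u , v), so it lies on π s u.
    light-edge-below-u : ∀ {y'} → parent y' ≡ y → UsesEdge y y' (πs x C) → y' ≼ u
    light-edge-below-u y'↑y (inj₁ m) = on-πs y'↑y (zip-drop⇒Consecutive (πs x C) m) (inj₁ (refl , refl))
    light-edge-below-u y'↑y (inj₂ m) = on-πs y'↑y (zip-drop⇒Consecutive (πs x C) m) (inj₂ (refl , refl))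

    target-witness : y ≡ u ⊎ Σ (Fin n) λ y' → IsLight y' × y' ≼ u × parent y' ≡ y × x ∈ πs y y'
    target-witness with proj₂ (comp-choice x y pair)
    ... | inj₁ y≡u = inj₁ y≡u
    ... | inj₂ (y' , ((y'↑y , y'≢y) , y'≢h) , uses , x∈) =
      inj₂ (y' , (y'≢s , subst (λ t → y' ≢ heavy t) (sym y'↑y) y'≢h) , light-edge-below-u y'↑y uses , y'↑y , x∈)
      where
      y'≢s : y' ≢ s
      y'≢s refl = y'≢y (trans (sym parent-root) y'↑y)

    y≼u : y ≼ u
    y≼u with target-witness
    ... | inj₁ y≡u                       = subst (_≼ u) (sym y≡u) ≼-refl
    ... | inj₂ (_ , _ , y'≼u , refl , _) = ≼-parent y'≼u

    y∈targets : y ∈ targetsOf u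
    y∈targets with target-witness
    ... | inj₁ y≡u = here y≡u
    ... | inj₂ (y' , light , y'≼u , refl , _) =
      there (∈-map⁺ parent (∈-filter⁺ light? (≼⇒∈-up y'≼u (depth≤D u)) light))

    -- Below x on the tree path to v we stay in the component C of G[V_x].
    ∈-candidates-below-x : ∀ {z} → z ≼ v → depth x < depth z → (x , y) ∈ candidates z
    ∈-candidates-below-x {z} z≼v x<z =
      ∈-++⁺ˡ (∈-descentCandidates (≼-by-depth x≼v z≼v (<⇒≤ x<z))
                (subst (λ e → y ∈ targetsOf (proj₁ e)) same-exit y∈targets))
      where
      same-exit : exit x C ≡ exit x z
      same-exit = trans (proj₂ exit-choice x C v x≢s C⇝v) (proj₂ exit-choice x v z x≢s (≼-connected x≼v z≼v x<z))

    descent-edge : ∀ {a b} → Consecutive a b (π x v) → (x , y) ∈ candidates a ⊎ (x , y) ∈ candidates b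
    descent-edge c with π-edge-descending x≼v c
    ... | z , edge , z≼v , x<z = at-endpoint edge (∈-candidates-below-x z≼v x<z)

    ascent-edge : ∀ {a b} → Consecutive a b (π u y) → (x , y) ∈ candidates a ⊎ (x , y) ∈ candidates b
    ascent-edge c with π-edge-ascending y≼u c | target-witness
    ... | z , _ , z≼u , y<z | inj₁ y≡u = ⊥-elim (<⇒≱ y<z (subst (λ t → depth z ≤ depth t) (sym y≡u) (≼⇒depth≤ z≼u)))
    ... | z , edge , z≼u , y<z | inj₂ (y' , light , y'≼u , refl , x∈) =
      at-endpoint edge (∈-++⁺ʳ (descentCandidates z) (∈-ascentCandidates light y'≼z x∈))
      where
      y'≼z : y' ≼ z
      y'≼z = ≼-by-depth y'≼u z≼u (subst (_≤ depth z) (depth-parent (proj₁ light)) y<z)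

    Π-edge : ∀ {a b} → Consecutive a b (Π x y) → (x , y) ∈ candidates a ⊎ (x , y) ∈ candidates b
    Π-edge c with Consecutive-++⁻ (π x v) (π u y) c
    ... | inj₁ c-xv                  = descent-edge c-xv
    ... | inj₂ (inj₁ c-uy)           = ascent-edge c-uy
    ... | inj₂ (inj₂ (last-a , _))   =
      inj₁ (subst (λ a → (x , y) ∈ candidates a) (sym (Last-π x v last-a)) (∈-candidates-below-x ≼-refl x<v))

    Π-uses⇒∈edgeCandidates : ∀ {a b} → UsesEdge a b (Π x y) → (x , y) ∈ edgeCandidates a b
    Π-uses⇒∈edgeCandidates {a} (inj₁ m) =
      [ ∈-++⁺ˡ , ∈-++⁺ʳ (candidates a) ] (Π-edge (zip-drop⇒Consecutive (Π x y) m))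
    Π-uses⇒∈edgeCandidates {a} (inj₂ m) =
      [ ∈-++⁺ʳ (candidates a) , ∈-++⁺ˡ ] (Π-edge (zip-drop⇒Consecutive (Π x y) m))

  length-targetsOf : ∀ u → length (targetsOf u) ≤ suc ⌊log₂ n ⌋
  length-targetsOf u = s≤s (subst (_≤ ⌊log₂ n ⌋) (sym (length-map parent (lightAncestors D u)))
                                 (length-lightAncestors≤log D u))

  length-πs : ∀ a b → length (πs a b) ≤ suc (D + D) + 1
  length-πs a b rewrite length-++ (π s (proj₁ (exit a b))) {proj₂ (exit a b) ∷ []} =
    +-monoˡ-≤ 1 (length-π≤ s (proj₁ (exit a b)))

  length-descentCandidates : ∀ w → length (descentCandidates w) ≤ suc D * suc ⌊log₂ n ⌋
  length-descentCandidates w = subst (λ k → length (descentCandidates w) ≤ k * suc ⌊log₂ n ⌋) (length-up D w)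
    (length-concatMap≤ (λ x → map (x ,_) (targetsOf (proj₁ (exit x w)))) (up D w)
      (λ {x} _ → subst (_≤ suc ⌊log₂ n ⌋) (sym (length-map (x ,_) (targetsOf (proj₁ (exit x w)))))
                   (length-targetsOf (proj₁ (exit x w)))))

  length-ascentCandidates : ∀ w → length (ascentCandidates w) ≤ ⌊log₂ n ⌋ * (suc (D + D) + 1)
  length-ascentCandidates w = ≤-trans
    (length-concatMap≤ (λ y' → map (_, parent y') (πs (parent y') y')) (lightAncestors D w)
      (λ {y'} _ → subst (_≤ suc (D + D) + 1) (sym (length-map (_, parent y') (πs (parent y') y')))
                    (length-πs (parent y') y')))
    (*-monoˡ-≤ (suc (D + D) + 1) (length-lightAncestors≤log D w))

  length-candidates : ∀ w → length (candidates w) ≤ suc D * suc ⌊log₂ n ⌋ + ⌊log₂ n ⌋ * (suc (D + D) + 1)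
  length-candidates w rewrite length-++ (descentCandidates w) {ascentCandidates w} =
    +-mono-≤ (length-descentCandidates w) (length-ascentCandidates w)

  light-path-length : ∀ {x y} → OrderedLightPair x y → pathLength (Π x y) ≤ 12 * D
  light-path-length {x} {y} pair = begin
    length (Π x y) ∸ 1                    ≤⟨ m∸n≤m (length (Π x y)) 1 ⟩
    length (Π x y)                        ≡⟨ length-++ (π x v) {π u y} ⟩
    length (π x v) + length (π u y)       ≤⟨ +-mono-≤ (length-π≤ x v) (length-π≤ u y) ⟩
    suc (D + D) + suc (D + D)             ≤⟨ path-length-bound D (light-pair⇒D>0 pair) ⟩
    12 * D                                ∎
    where
    open ≤-Reasoning
    u = proj₁ (exit x (comp x y))
    v = proj₂ (exit x (comp x y))

  edge-load : ∀ a b (L : List (Fin n × Fin n)) → Unique L →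
              All (λ p → OrderedLightPair (proj₁ p) (proj₂ p)) L →
              All (λ p → UsesEdge a b (Π (proj₁ p) (proj₂ p))) L →
              length L ≤ 12 * D * suc ⌊log₂ n ⌋ ^ 12
  edge-load a b []      _      _             _    = z≤n
  edge-load a b (p ∷ L) unique pairs@(pair ∷ _) uses = begin
    length (p ∷ L)               ≤⟨ Unique-⊆⇒length≤ unique (λ m → Π-uses⇒∈edgeCandidates
                                                                      (All.lookup pairs m) (All.lookup uses m)) ⟩
    length (edgeCandidates a b)  ≡⟨ length-++ (candidates a) {candidates b} ⟩
    length (candidates a) + length (candidates b)
                                 ≤⟨ +-mono-≤ (length-candidates a) (length-candidates b) ⟩
    B + B                        ≤⟨ candidate-count-bound D ⌊log₂ n ⌋ (light-pair⇒D>0 pair) ⟩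
    12 * D * suc ⌊log₂ n ⌋ ^ 12  ∎
    where
    open ≤-Reasoning
    B = suc D * suc ⌊log₂ n ⌋ + ⌊log₂ n ⌋ * (suc (D + D) + 1)

lemma4p19 : Σ ℕ λ c →
    ∀ {n} (G : Graph n) (D : ℕ) (s : Fin n) (parent : Fin n → Fin n)
      (heavy : Fin n → Fin n) (exit : Fin n → Fin n → Fin n × Fin n)
      (comp : Fin n → Fin n → Fin n) →
    GraphNotions.IsDiameter G D →
    GraphNotions.NoCutVertex G →
    GraphNotions.IsBFSTree G s parent →
    Light.IsHeavyChoice G s parent heavy exit comp →
    Light.IsExitChoice G s parent heavy exit comp →
    Light.IsCompChoice G s parent heavy exit comp →
    (∀ x y → Light.OrderedLightPair G s parent heavy exit comp x y →
       pathLength (Light.Π G s parent heavy exit comp x y) ≤ c * D)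
    × (∀ a b → Graph.adj G a b ≡ true →
       (L : List (Fin n × Fin n)) → Unique L →
       All (λ p → Light.OrderedLightPair G s parent heavy exit comp (proj₁ p) (proj₂ p)) L →
       All (λ p → UsesEdge a b (Light.Π G s parent heavy exit comp (proj₁ p) (proj₂ p))) L →
       length L ≤ c * D * suc ⌊log₂ n ⌋ ^ c)
lemma4p19 = 12 , λ G D s parent heavy exit comp diam _ bfs heavy-choice exit-choice comp-choice →
  let open LightPairs G D s parent heavy exit comp diam bfs heavy-choice exit-choice comp-choice in
  (λ _ _ → light-path-length) , λ a b _ → edge-load a b
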